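{- Let $p$ be a prime and $t\ge 1$ an integer; set $r := p^t+1$. Let $f\colon\mathbb{Z}\to\mathbb{F}_p$ be the function determined by $f(k+r) = -f(k)-f(k+1)$ for all $k\in\mathbb{Z}$, together with $f(0)=1$ and $f(1)=\dots=f(r-1)=0$. Then $n := r(r-1)+1$ is a period of $f$, i.e., $f(k+n)=f(k)$ for all $k\in\mathbb{Z}$. -}

module Defs where

open import Data.Nat using (ℕ)
open import Data.Integer using (ℤ; +_; _-_)
open import Data.Integer.Divisibility using (_∣_)

-- Congruence of integers modulo a natural number p.
-- An F_p-valued function is represented by integer representatives;
-- equality in F_p = ℤ/pℤ is congruence mod p.
_≡_[mod_] : ℤ → ℤ → ℕ → Set
a ≡ b [mod p ] = (+ p) ∣ (a - b)

-- Write E for the shift (E g) k = g (k + 1). Modulo p the recurrence says E^r f = -(1 + E) f, hence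
-- E^(m r) f = (-1)^m (1 + E)^m f. For q = p^t the inner binomial coefficients C(q, j), 0 < j < q, are
-- divisible by p, so (1 + E)^q ≡ 1 + E^q, and also (-1)^q ≡ -1. As r = q + 1, this gives
-- E^(q r + 1) f = -E (1 + E^q) f = -(E f + E^r f) = -(E f - f - E f) = f.

module Submission where

open import Data.Empty using (⊥-elim)
open import Data.Integer using (ℤ; +_; _+_; -_; _-_; _*_; 0ℤ; 1ℤ; -1ℤ)
  renaming (_^_ to _^ℤ_)
import Data.Integer.Divisibility.Signed as ℤ∣
open import Data.Integer.Properties
open import Data.Integer.Tactic.RingSolver using (solve-∀)
open import Data.Nat as ℕ using (ℕ; zero; suc; _≤_; _<_; _^_; z<s; s<s; NonZero)
open import Data.Nat.Combinatorics
  using (_C_; nC1≡n; nCn≡1; k>n⇒nCk≡0; nCk+nC[k+1]≡[n+1]C[k+1])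
open import Data.Nat.Divisibility
  using (_∣_; divides; _∣0; 1∣_; ∣-refl; ∣-trans; m∣m*n; ∣m⇒∣m*n; *-monoʳ-∣; *-cancelˡ-∣; ∣⇒≤)
open import Data.Nat.Primality using (Prime; euclidsLemma; prime⇒irreducible; prime⇒nonZero)
import Data.Nat.Properties as ℕₚ
import Data.Nat.Tactic.RingSolver as ℕ-Solver
open import Data.Sum using (_⊎_; inj₁; inj₂)
open import Function using (_∘_)
open import Level using (0ℓ)
open import Relation.Binary using (Rel; Setoid; IsEquivalence; _Preserves₂_⟶_⟶_)
open import Relation.Binary.PropositionalEquality
import Relation.Binary.Reasoning.Setoid as SetoidReasoning
import Algebra.Properties.CommutativeSemigroup ℕₚ.*-commutativeSemigroup as ℕ*
import Algebra.Properties.CommutativeSemigroup +-commutativeSemigroup as ℤ+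

open import Defs

infixl 10 ∑<
∑< : ℕ → (ℕ → ℤ) → ℤ
∑< zero    h = 0ℤ
∑< (suc n) h = h 0 + ∑< n (h ∘ suc)

syntax ∑< n (λ j → e) = ∑[ j < n ] e

∑-preserves : ∀ {ℓ} (_∼_ : Rel ℤ ℓ) → 0ℤ ∼ 0ℤ → _+_ Preserves₂ _∼_ ⟶ _∼_ ⟶ _∼_ →
              ∀ n {h g} → (∀ j → h j ∼ g j) → ∑< n h ∼ ∑< n g
∑-preserves _∼_ 0∼0 +-pres zero    h∼g = 0∼0
∑-preserves _∼_ 0∼0 +-pres (suc n) h∼g = +-pres (h∼g 0) (∑-preserves _∼_ 0∼0 +-pres n (h∼g ∘ suc))

∑-cong : ∀ n {h g} → (∀ j → h j ≡ g j) → ∑< n h ≡ ∑< n g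
∑-cong = ∑-preserves _≡_ refl (cong₂ _+_)

∑-distrib-+ : ∀ n h g → ∑[ j < n ] (h j + g j) ≡ ∑< n h + ∑< n g
∑-distrib-+ zero    h g = refl
∑-distrib-+ (suc n) h g = begin
  (h 0 + g 0) + ∑[ j < n ] (h (suc j) + g (suc j))
    ≡⟨ cong (_+_ (h 0 + g 0)) (∑-distrib-+ n (h ∘ suc) (g ∘ suc)) ⟩
  (h 0 + g 0) + (∑< n (h ∘ suc) + ∑< n (g ∘ suc))
    ≡⟨ interchange (h 0) (g 0) _ _ ⟩
  (h 0 + ∑< n (h ∘ suc)) + (g 0 + ∑< n (g ∘ suc)) ∎
  where
  open ≡-Reasoning
  interchange : ∀ a b c d → (a + b) + (c + d) ≡ (a + c) + (b + d)
  interchange = solve-∀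

∑-neg : ∀ n h → ∑[ j < n ] (- h j) ≡ - ∑< n h
∑-neg zero    h = refl
∑-neg (suc n) h = begin
  - h 0 + ∑[ j < n ] (- h (suc j)) ≡⟨ cong (_+_ (- h 0)) (∑-neg n (h ∘ suc)) ⟩
  - h 0 + - ∑< n (h ∘ suc)         ≡⟨ neg-distrib-+ (h 0) _ ⟨
  - (h 0 + ∑< n (h ∘ suc))         ∎
  where open ≡-Reasoning

∑-last : ∀ n h → ∑< (suc n) h ≡ ∑< n h + h n
∑-last zero    h = +-comm (h 0) 0ℤ
∑-last (suc n) h = begin
  h 0 + ∑< (suc n) (h ∘ suc)         ≡⟨ cong (_+_ (h 0)) (∑-last n (h ∘ suc)) ⟩
  h 0 + (∑< n (h ∘ suc) + h (suc n)) ≡⟨ +-assoc (h 0) _ _ ⟨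
  ∑< (suc n) h + h (suc n)           ∎
  where open ≡-Reasoning

[1+k]*[1+n]C[1+k]≡[1+n]*nCk : ∀ n k → suc k ℕ.* (suc n C suc k) ≡ suc n ℕ.* (n C k)
[1+k]*[1+n]C[1+k]≡[1+n]*nCk n zero = begin
  1 ℕ.* (suc n C 1) ≡⟨ ℕₚ.*-identityˡ _ ⟩
  suc n C 1         ≡⟨ nC1≡n (suc n) ⟩
  suc n             ≡⟨ ℕₚ.*-identityʳ (suc n) ⟨
  suc n ℕ.* 1       ∎
  where open ≡-Reasoning
[1+k]*[1+n]C[1+k]≡[1+n]*nCk zero (suc k)
  rewrite k>n⇒nCk≡0 {1} {2 ℕ.+ k} (s<s z<s) | k>n⇒nCk≡0 {0} {suc k} z<s = ℕₚ.*-zeroʳ (2 ℕ.+ k)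
[1+k]*[1+n]C[1+k]≡[1+n]*nCk (suc n) (suc k) = begin
  (2 ℕ.+ k) ℕ.* C₂₂
    ≡⟨ cong ((2 ℕ.+ k) ℕ.*_) (nCk+nC[k+1]≡[n+1]C[k+1] (suc n) (suc k)) ⟨
  (2 ℕ.+ k) ℕ.* (C₁₁ ℕ.+ C₁₂)
    ≡⟨ rearrange k C₁₁ C₁₂ ⟩
  C₁₁ ℕ.+ ((1 ℕ.+ k) ℕ.* C₁₁ ℕ.+ (2 ℕ.+ k) ℕ.* C₁₂)
    ≡⟨ cong₂ (λ x y → C₁₁ ℕ.+ (x ℕ.+ y)) ([1+k]*[1+n]C[1+k]≡[1+n]*nCk n k)
                                          ([1+k]*[1+n]C[1+k]≡[1+n]*nCk n (suc k)) ⟩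
  C₁₁ ℕ.+ ((1 ℕ.+ n) ℕ.* (n C k) ℕ.+ (1 ℕ.+ n) ℕ.* (n C suc k))
    ≡⟨ cong (C₁₁ ℕ.+_) (ℕₚ.*-distribˡ-+ (suc n) (n C k) (n C suc k)) ⟨
  C₁₁ ℕ.+ (1 ℕ.+ n) ℕ.* (n C k ℕ.+ n C suc k)
    ≡⟨ cong (λ x → C₁₁ ℕ.+ (1 ℕ.+ n) ℕ.* x) (nCk+nC[k+1]≡[n+1]C[k+1] n k) ⟩
  (2 ℕ.+ n) ℕ.* C₁₁ ∎
  where
  open ≡-Reasoning
  C₁₁ = suc n C suc k
  C₁₂ = suc n C suc (suc k)
  C₂₂ = suc (suc n) C suc (suc k)
  rearrange : ∀ k a b → (2 ℕ.+ k) ℕ.* (a ℕ.+ b) ≡ a ℕ.+ ((1 ℕ.+ k) ℕ.* a ℕ.+ (2 ℕ.+ k) ℕ.* b)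
  rearrange = ℕ-Solver.solve-∀

p^k∣m*n⇒p∣n⊎p^k∣m : ∀ {p} → Prime p → ∀ k {m n} → p ^ k ∣ m ℕ.* n → p ∣ n ⊎ p ^ k ∣ m
p^k∣m*n⇒p∣n⊎p^k∣m pp zero {m} _ = inj₂ (1∣ m)
p^k∣m*n⇒p∣n⊎p^k∣m {p} pp (suc k) {m} {n} p^[1+k]∣m*n
  with euclidsLemma m n pp (∣-trans (m∣m*n (p ^ k)) p^[1+k]∣m*n)
... | inj₂ p∣n = inj₁ p∣n
... | inj₁ (divides m′ refl)
  with p^k∣m*n⇒p∣n⊎p^k∣m pp k
         (*-cancelˡ-∣ p {{prime⇒nonZero pp}} (subst (p ^ suc k ∣_) (ℕ*.xy∙z≈y∙xz m′ p n) p^[1+k]∣m*n))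
... | inj₁ p∣n    = inj₁ p∣n
... | inj₂ p^k∣m′ = inj₂ (subst (p ^ suc k ∣_) (ℕₚ.*-comm p m′) (*-monoʳ-∣ p p^k∣m′))

p∣nCk : ∀ {p t n k} → Prime p → p ^ t ∣ n → 0 < k → k < p ^ t → p ∣ n C k
p∣nCk {p} {n = zero} {suc k} _ _ _ _ = subst (p ∣_) (sym (k>n⇒nCk≡0 {0} {suc k} z<s)) (p ∣0)
p∣nCk {p} {t} {suc n} {suc k} pp p^t∣n _ k<p^t
  with p^k∣m*n⇒p∣n⊎p^k∣m pp t
         (subst (p ^ t ∣_) (sym ([1+k]*[1+n]C[1+k]≡[1+n]*nCk n k)) (∣m⇒∣m*n (n C k) p^t∣n))
... | inj₁ p∣C   = p∣C
... | inj₂ p^t∣k = ⊥-elim (ℕₚ.<⇒≱ k<p^t (∣⇒≤ p^t∣k))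

-- binomialSum m g = (1 + E)^m g, expanded by the binomial theorem
binomialSum : ℕ → (ℤ → ℤ) → ℤ → ℤ
binomialSum m g k = ∑[ j < suc m ] (+ (m C j) * g (k + + j))

binomialSum-pascal : ∀ m g k →
                     binomialSum (suc m) g k ≡ binomialSum m g k + binomialSum m g (k + + 1)
binomialSum-pascal m g k = begin
  binomialSum (suc m) g k
    ≡⟨ cong (_+_ (a 0)) (∑-cong (suc m) split) ⟩
  a 0 + ∑[ j < suc m ] (a (suc j) + b j)
    ≡⟨ cong (_+_ (a 0)) (∑-distrib-+ (suc m) (a ∘ suc) b) ⟩
  a 0 + (∑< (suc m) (a ∘ suc) + ∑< (suc m) b)
    ≡⟨ +-assoc (a 0) _ _ ⟨
  ∑< (suc (suc m)) a + ∑< (suc m) b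
    ≡⟨ cong (_+ ∑< (suc m) b) (∑-last (suc m) a) ⟩
  (binomialSum m g k + a (suc m)) + ∑< (suc m) b
    ≡⟨ cong (λ c → (binomialSum m g k + + c * g (k + + suc m)) + ∑< (suc m) b)
            (k>n⇒nCk≡0 {m} {suc m} (ℕₚ.n<1+n m)) ⟩
  (binomialSum m g k + 0ℤ) + ∑< (suc m) b
    ≡⟨ cong (_+ ∑< (suc m) b) (+-identityʳ (binomialSum m g k)) ⟩
  binomialSum m g k + binomialSum m g (k + + 1) ∎
  where
  open ≡-Reasoning
  a b : ℕ → ℤ
  a j = + (m C j) * g (k + + j)
  b j = + (m C j) * g ((k + + 1) + + j)
  split : ∀ j → + (suc m C suc j) * g (k + + suc j) ≡ a (suc j) + b j
  split j = begin
    + (suc m C suc j) * g (k + + suc j)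
      ≡⟨ cong (λ c → + c * g (k + + suc j)) (nCk+nC[k+1]≡[n+1]C[k+1] m j) ⟨
    + (m C j ℕ.+ m C suc j) * g (k + + suc j)
      ≡⟨ cong (_* g (k + + suc j)) (pos-+ (m C j) (m C suc j)) ⟩
    (+ (m C j) + + (m C suc j)) * g (k + + suc j)
      ≡⟨ *-distribʳ-+ (g (k + + suc j)) (+ (m C j)) (+ (m C suc j)) ⟩
    + (m C j) * g (k + + suc j) + a (suc j)
      ≡⟨ +-comm _ (a (suc j)) ⟩
    a (suc j) + + (m C j) * g (k + + suc j)
      ≡⟨ cong (λ i → a (suc j) + + (m C j) * g i) (+-assoc k (+ 1) (+ j)) ⟨
    a (suc j) + b j ∎

-1^n≡-1⊎2∣n : ∀ n → -1ℤ ^ℤ n ≡ -1ℤ ⊎ 2 ∣ n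
-1^n≡-1⊎2∣n zero          = inj₂ (2 ∣0)
-1^n≡-1⊎2∣n (suc zero)    = inj₁ refl
-1^n≡-1⊎2∣n (suc (suc n)) with -1^n≡-1⊎2∣n n
... | inj₁ -1^n≡-1         =
  inj₁ (trans (sym (*-assoc -1ℤ -1ℤ (-1ℤ ^ℤ n))) (trans (*-identityˡ (-1ℤ ^ℤ n)) -1^n≡-1))
... | inj₂ (divides q refl) = inj₂ (divides (suc q) refl)

i^m≡i⇒i^[m^t]≡i : ∀ i m → i ^ℤ m ≡ i → ∀ t → i ^ℤ (m ^ t) ≡ i
i^m≡i⇒i^[m^t]≡i i m i^m≡i zero    = ^-identityʳ i
i^m≡i⇒i^[m^t]≡i i m i^m≡i (suc t) = begin
  i ^ℤ (m ℕ.* m ^ t)   ≡⟨ ^-*-assoc i m (m ^ t) ⟨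
  (i ^ℤ m) ^ℤ (m ^ t)  ≡⟨ cong (_^ℤ (m ^ t)) i^m≡i ⟩
  i ^ℤ (m ^ t)         ≡⟨ i^m≡i⇒i^[m^t]≡i i m i^m≡i t ⟩
  i                    ∎
  where open ≡-Reasoning

module Modulo (p : ℕ) where

  -- Unfolded, _≡_[mod p ] is a statement about a - b from which Agda cannot infer a and b.
  infix 4 _≈_
  record _≈_ (a b : ℤ) : Set where
    constructor mk≈
    field
      p∣a-b : + p ℤ∣.∣ (a - b)

  ≡[mod]⇒≈ : ∀ {a b} → a ≡ b [mod p ] → a ≈ b
  ≡[mod]⇒≈ {a} {b} = mk≈ ∘ ℤ∣.∣ᵤ⇒∣ {+ p} {a - b}

  ≈⇒≡[mod] : ∀ {a b} → a ≈ b → a ≡ b [mod p ]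
  ≈⇒≡[mod] {a} {b} (mk≈ p∣a-b) = ℤ∣.∣⇒∣ᵤ {+ p} {a - b} p∣a-b

  private
    mk≈-via : ∀ {a b x} → x ≡ a - b → + p ℤ∣.∣ x → a ≈ b
    mk≈-via refl = mk≈

  ≈-reflexive : ∀ {a b} → a ≡ b → a ≈ b
  ≈-reflexive {a} refl = mk≈-via (sym (+-inverseʳ a)) (ℤ∣.divides 0ℤ refl)

  ≈-refl : ∀ {a} → a ≈ a
  ≈-refl = ≈-reflexive refl

  ≈-sym : ∀ {a b} → a ≈ b → b ≈ a
  ≈-sym {a} {b} (mk≈ p∣a-b) = mk≈-via (eq a b) (ℤ∣.∣m⇒∣-m p∣a-b)
    where eq : ∀ a b → - (a - b) ≡ b - a
          eq = solve-∀

  ≈-trans : ∀ {a b c} → a ≈ b → b ≈ c → a ≈ c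
  ≈-trans {a} {b} {c} (mk≈ p∣a-b) (mk≈ p∣b-c) = mk≈-via (eq a b c) (ℤ∣.∣m∣n⇒∣m+n p∣a-b p∣b-c)
    where eq : ∀ a b c → (a - b) + (b - c) ≡ a - c
          eq = solve-∀

  ≈-isEquivalence : IsEquivalence _≈_
  ≈-isEquivalence = record { refl = ≈-refl ; sym = ≈-sym ; trans = ≈-trans }

  ≈-setoid : Setoid 0ℓ 0ℓ
  ≈-setoid = record { isEquivalence = ≈-isEquivalence }

  module ≈-Reasoning = SetoidReasoning ≈-setoid

  +-cong : _+_ Preserves₂ _≈_ ⟶ _≈_ ⟶ _≈_
  +-cong {a} {b} {c} {d} (mk≈ p∣a-b) (mk≈ p∣c-d) = mk≈-via (eq a b c d) (ℤ∣.∣m∣n⇒∣m+n p∣a-b p∣c-d)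
    where eq : ∀ a b c d → (a - b) + (c - d) ≡ (a + c) - (b + d)
          eq = solve-∀

  *-congˡ : ∀ c {a b} → a ≈ b → c * a ≈ c * b
  *-congˡ c {a} {b} (mk≈ p∣a-b) = mk≈-via (eq c a b) (ℤ∣.∣n⇒∣m*n c p∣a-b)
    where eq : ∀ c a b → c * (a - b) ≡ c * a - c * b
          eq = solve-∀

  *-congʳ : ∀ c {a b} → a ≈ b → a * c ≈ b * c
  *-congʳ c {a} {b} (mk≈ p∣a-b) = mk≈-via (eq c a b) (ℤ∣.∣m⇒∣m*n c p∣a-b)
    where eq : ∀ c a b → (a - b) * c ≡ a * c - b * c
          eq = solve-∀

  ∣⇒*≈0 : ∀ {c} a → p ∣ c → + c * a ≈ 0ℤ
  ∣⇒*≈0 {c} a p∣c = mk≈-via (sym (+-identityʳ (+ c * a))) (ℤ∣.∣m⇒∣m*n a (ℤ∣.∣ᵤ⇒∣ {+ p} {+ c} p∣c))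

  ∑≈0 : ∀ n {h} → (∀ j → j < n → h j ≈ 0ℤ) → ∑< n h ≈ 0ℤ
  ∑≈0 zero    _   = ≈-refl
  ∑≈0 (suc n) h≈0 = +-cong (h≈0 0 z<s) (∑≈0 n (λ j j<n → h≈0 (suc j) (s<s j<n)))

  binomialSum-ends : ∀ m .{{_ : NonZero m}} → (∀ {j} → 0 < j → j < m → p ∣ m C j) →
                     ∀ g k → binomialSum m g k ≈ g k + g (k + + m)
  binomialSum-ends (suc m) p∣mCj g k = begin
    binomialSum (suc m) g k
      ≡⟨ ∑-last (suc m) a ⟩
    (a 0 + ∑[ j < m ] a (suc j)) + a (suc m)
      ≈⟨ +-cong (+-cong (≈-reflexive first) middle) (≈-reflexive last) ⟩
    (g k + 0ℤ) + g (k + + suc m)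
      ≡⟨ cong (_+ g (k + + suc m)) (+-identityʳ (g k)) ⟩
    g k + g (k + + suc m) ∎
    where
    open ≈-Reasoning
    a : ℕ → ℤ
    a j = + (suc m C j) * g (k + + j)
    first : a 0 ≡ g k
    first = trans (*-identityˡ (g (k + + 0))) (cong g (+-identityʳ k))
    middle : ∑[ j < m ] a (suc j) ≈ 0ℤ
    middle = ∑≈0 m (λ j j<m → ∣⇒*≈0 (g (k + + suc j)) (p∣mCj z<s (s<s j<m)))
    last : a (suc m) ≡ g (k + + suc m)
    last = trans (cong (λ c → + c * g (k + + suc m)) (nCn≡1 (suc m))) (*-identityˡ (g (k + + suc m)))

  binomialSum-frobenius : Prime p → ∀ t g k → binomialSum (p ^ t) g k ≈ g k + g (k + + (p ^ t))
  binomialSum-frobenius pp t =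
    binomialSum-ends (p ^ t) {{ℕₚ.m^n≢0 p t {{prime⇒nonZero pp}}}} (p∣nCk {t = t} pp ∣-refl)

  module Recurrence (r : ℕ) (f : ℤ → ℤ) (rec : ∀ k → f (k + + r) ≈ - f k - f (k + + 1)) where

    binomialSum-recurrence : ∀ m k → binomialSum m f (k + + r) ≈ - binomialSum (suc m) f k
    binomialSum-recurrence m k = begin
      binomialSum m f (k + + r)
        ≈⟨ ∑-preserves _≈_ ≈-refl +-cong (suc m) (λ j → *-congˡ (+ (m C j)) (rec-at j)) ⟩
      ∑[ j < suc m ] (+ (m C j) * (- f (k + + j) - f ((k + + 1) + + j)))
        ≡⟨ ∑-cong (suc m) (λ j → distrib (+ (m C j)) (f (k + + j)) (f ((k + + 1) + + j))) ⟩
      ∑[ j < suc m ] (- a j + - b j)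
        ≡⟨ ∑-distrib-+ (suc m) (-_ ∘ a) (-_ ∘ b) ⟩
      ∑[ j < suc m ] (- a j) + ∑[ j < suc m ] (- b j)
        ≡⟨ cong₂ _+_ (∑-neg (suc m) a) (∑-neg (suc m) b) ⟩
      - binomialSum m f k + - binomialSum m f (k + + 1)
        ≡⟨ neg-distrib-+ (binomialSum m f k) (binomialSum m f (k + + 1)) ⟨
      - (binomialSum m f k + binomialSum m f (k + + 1))
        ≡⟨ cong -_ (binomialSum-pascal m f k) ⟨
      - binomialSum (suc m) f k ∎
      where
      open ≈-Reasoning
      a b : ℕ → ℤ
      a j = + (m C j) * f (k + + j)
      b j = + (m C j) * f ((k + + 1) + + j)
      distrib : ∀ c x y → c * (- x - y) ≡ - (c * x) + - (c * y)
      distrib = solve-∀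
      rec-at : ∀ j → f ((k + + r) + + j) ≈ - f (k + + j) - f ((k + + 1) + + j)
      rec-at j = begin
        f ((k + + r) + + j)                 ≡⟨ cong f (ℤ+.xy∙z≈xz∙y k (+ r) (+ j)) ⟩
        f ((k + + j) + + r)                 ≈⟨ rec (k + + j) ⟩
        - f (k + + j) - f ((k + + j) + + 1) ≡⟨ cong (λ i → - f (k + + j) - f i)
                                                      (ℤ+.xy∙z≈xz∙y k (+ j) (+ 1)) ⟩
        - f (k + + j) - f ((k + + 1) + + j) ∎

    iterated-recurrence : ∀ m k → f (k + + (m ℕ.* r)) ≈ -1ℤ ^ℤ m * binomialSum m f k
    iterated-recurrence zero k = ≈-reflexive (sym (begin
      1ℤ * (1ℤ * f (k + + 0) + 0ℤ) ≡⟨ *-identityˡ _ ⟩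
      1ℤ * f (k + + 0) + 0ℤ        ≡⟨ +-identityʳ _ ⟩
      1ℤ * f (k + + 0)             ≡⟨ *-identityˡ _ ⟩
      f (k + + 0)                  ∎))
      where open ≡-Reasoning
    iterated-recurrence (suc m) k = begin
      f (k + + (r ℕ.+ m ℕ.* r))         ≡⟨ cong f shift ⟩
      f ((k + + r) + + (m ℕ.* r))       ≈⟨ iterated-recurrence m (k + + r) ⟩
      s * binomialSum m f (k + + r)     ≈⟨ *-congˡ s (binomialSum-recurrence m k) ⟩
      s * - binomialSum (suc m) f k     ≡⟨ neg-distribʳ-* s _ ⟨
      - (s * binomialSum (suc m) f k)   ≡⟨ -1*i≡-i _ ⟨
      -1ℤ * (s * binomialSum (suc m) f k) ≡⟨ *-assoc -1ℤ s _ ⟨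
      -1ℤ * s * binomialSum (suc m) f k ∎
      where
      open ≈-Reasoning
      s = -1ℤ ^ℤ m
      shift : k + + (r ℕ.+ m ℕ.* r) ≡ (k + + r) + + (m ℕ.* r)
      shift = trans (cong (_+_ k) (pos-+ r (m ℕ.* r))) (sym (+-assoc k (+ r) (+ (m ℕ.* r))))

  recurrence-period : ∀ q → (∀ g k → binomialSum q g k ≈ g k + g (k + + q)) → -1ℤ ^ℤ q ≈ -1ℤ →
                      ∀ f → (∀ k → f (k + + (q ℕ.+ 1)) ≈ - f k - f (k + + 1)) →
                      ∀ k → f (k + + ((q ℕ.+ 1) ℕ.* q ℕ.+ 1)) ≈ f k
  recurrence-period q frobenius sign f rec k = begin
    f (k + + ((q ℕ.+ 1) ℕ.* q ℕ.+ 1))         ≡⟨ cong f index ⟩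
    f ((k + + 1) + + (q ℕ.* (q ℕ.+ 1)))       ≈⟨ iterated-recurrence q (k + + 1) ⟩
    s * binomialSum q f (k + + 1)             ≈⟨ *-congˡ s (frobenius f (k + + 1)) ⟩
    s * (f (k + + 1) + f ((k + + 1) + + q))   ≡⟨ cong (λ i → s * (f (k + + 1) + f i)) index′ ⟩
    s * (f (k + + 1) + f (k + + (q ℕ.+ 1)))   ≈⟨ *-congˡ s (+-cong (≈-refl {f (k + + 1)}) (rec k)) ⟩
    s * (f (k + + 1) + (- f k - f (k + + 1))) ≡⟨ cancel s (f k) (f (k + + 1)) ⟩
    s * - f k                                 ≈⟨ *-congʳ (- f k) sign ⟩
    -1ℤ * - f k                               ≡⟨ -1*i≡-i (- f k) ⟩
    - - f k                                   ≡⟨ neg-involutive (f k) ⟩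
    f k                                       ∎
    where
    open ≈-Reasoning
    open Recurrence (q ℕ.+ 1) f rec
    s = -1ℤ ^ℤ q
    index : k + + ((q ℕ.+ 1) ℕ.* q ℕ.+ 1) ≡ (k + + 1) + + (q ℕ.* (q ℕ.+ 1))
    index = trans (cong (λ n → k + + n) (reorder q))
                  (trans (cong (_+_ k) (pos-+ 1 (q ℕ.* (q ℕ.+ 1)))) (sym (+-assoc k (+ 1) _)))
      where reorder : ∀ q → (q ℕ.+ 1) ℕ.* q ℕ.+ 1 ≡ 1 ℕ.+ q ℕ.* (q ℕ.+ 1)
            reorder = ℕ-Solver.solve-∀
    index′ : (k + + 1) + + q ≡ k + + (q ℕ.+ 1)
    index′ = trans (+-assoc k (+ 1) (+ q))
                   (cong (_+_ k) (trans (sym (pos-+ 1 q)) (cong +_ (ℕₚ.+-comm 1 q))))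
    cancel : ∀ s x y → s * (y + (- x - y)) ≡ s * - x
    cancel = solve-∀

-1^n≡-1[mod2] : ∀ n → (-1ℤ ^ℤ n) ≡ -1ℤ [mod 2 ]
-1^n≡-1[mod2] n = ≈⇒≡[mod] (-1^n≈-1 n)
  where
  open Modulo 2
  -1^n≈-1 : ∀ n → -1ℤ ^ℤ n ≈ -1ℤ
  -1^n≈-1 zero    = ≡[mod]⇒≈ ∣-refl
  -1^n≈-1 (suc n) = ≈-trans (*-congˡ -1ℤ (-1^n≈-1 n)) (-1^n≈-1 zero)

-1^[p^t]≡-1[modp] : ∀ {p} → Prime p → ∀ t → (-1ℤ ^ℤ (p ^ t)) ≡ -1ℤ [mod p ]
-1^[p^t]≡-1[modp] {p} pp t with -1^n≡-1⊎2∣n p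
... | inj₁ -1^p≡-1 = Modulo.≈⇒≡[mod] p (Modulo.≈-reflexive p (i^m≡i⇒i^[m^t]≡i -1ℤ p -1^p≡-1 t))
... | inj₂ 2∣p with prime⇒irreducible pp 2∣p
...   | inj₂ refl = -1^n≡-1[mod2] (2 ^ t)

lemma3p6 : (p t : ℕ) → Prime p → 1 ≤ t →
           (f : ℤ → ℤ) →
           (∀ (k : ℤ) → f (k + + (p ^ t ℕ.+ 1)) ≡ (- f k) - f (k + + 1) [mod p ]) →
           f (+ 0) ≡ + 1 [mod p ] →
           (∀ (i : ℕ) → 1 ≤ i → i ℕ.< p ^ t ℕ.+ 1 → f (+ i) ≡ + 0 [mod p ]) →
           ∀ (k : ℤ) → f (k + + ((p ^ t ℕ.+ 1) ℕ.* (p ^ t) ℕ.+ 1)) ≡ f k [mod p ]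
-- The initial values and t ≥ 1 are not needed: every solution of the recurrence has this period.
lemma3p6 p t pp _ f rec _ _ k =
  ≈⇒≡[mod] (recurrence-period (p ^ t) (binomialSum-frobenius pp t)
                                      (≡[mod]⇒≈ (-1^[p^t]≡-1[modp] pp t)) f (≡[mod]⇒≈ ∘ rec) k)
  where open Modulo p
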